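{- Let $F(X,Y)$ be a CNF formula over disjoint variable sets $X,Y$, let $\boldsymbol{q}$ be a partial assignment to $X$, and let $X',X''\subseteq X$ be such that $\mathit{Vars}(\boldsymbol{q}),X',X''$ are pairwise disjoint. Suppose the D-sequent $(F,X',\boldsymbol{q})\rightarrow X''$ holds modulo local irredundancy, i.e. $X'$ is redundant in $F_{\boldsymbol{q}}$ modulo local irredundancy and $X''$ is redundant in $\mathit{Dis}(F_{\boldsymbol{q}},X')$ modulo local irredundancy. Then $X'\cup X''$ is redundant in $F_{\boldsymbol{q}}$ modulo local irredundancy.
   Context: $\mathit{Vars}(\boldsymbol{q})$ is the set of variables assigned by $\boldsymbol{q}$. For a CNF formula $H$ over $V\cup Y$ with designated quantified set $V$: a point is a complete assignment to $V\cup Y$; a $Z'$-clause is a clause containing a variable of $Z'$ (otherwise non-$Z'$-clause); $\boldsymbol{p}$ is a $Z'$-boundary point of $H$ if $H(\boldsymbol{p})=0$, every clause of $H$ falsified by $\boldsymbol{p}$ is a $Z'$-clause, and this fails for every proper subset of $Z'$; $\boldsymbol{p}$ is a $Z'$-removable boundary point if it is a $Z''$-boundary point for some $Z''\subseteq Z'$ and some clause falsified by $\boldsymbol{p}$ is a non-$Z'$-clause implied by the conjunction of the $Z'$-clauses of $H$. $F_{\boldsymbol{q}}$ is obtained from $F$ by removing clauses satisfied by $\boldsymbol{q}$ and removing literals set to 0 by $\boldsymbol{q}$; it is a formula over $(X\setminus\mathit{Vars}(\boldsymbol{q}))\cup Y$ with quantified set $X\setminus\mathit{Vars}(\boldsymbol{q})$;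 $\mathit{Dis}(F_{\boldsymbol{q}},X')$ is obtained from $F_{\boldsymbol{q}}$ by discarding all $X'$-clauses (same variables and quantified set). For $H\in\{F_{\boldsymbol{q}},\mathit{Dis}(F_{\boldsymbol{q}},X')\}$ and $W\subseteq X\setminus\mathit{Vars}(\boldsymbol{q})$, $W$ is redundant in $H$ modulo local irredundancy if for every point $\boldsymbol{p}$ that is a $W'$-boundary point of $H$ for some $W'\subseteq W$ and an $(X\setminus\mathit{Vars}(\boldsymbol{q}))$-removable boundary point of $H$, there is an assignment $\boldsymbol{x}$ to $X$ with $F(\boldsymbol{x},\boldsymbol{y})=1$, where $\boldsymbol{y}$ is the restriction of $\boldsymbol{p}$ to $Y$. -}

module Defs where

open import Data.Nat using (ℕ)
open import Data.Bool using (Bool; true; false; not; _∧_)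
open import Data.Fin using (Fin)
open import Data.Fin.Subset using (Subset; _∈_; _⊆_; _⊂_; _─_; _∪_)
open import Data.Maybe using (Maybe; just; nothing; is-just)
open import Data.Vec using (tabulate; lookup)
open import Data.List using (List; map; filterᵇ)
open import Data.Bool.ListAction using (any)
open import Data.List.Membership.Propositional using () renaming (_∈_ to _∈ₗ_)
open import Data.List.Relation.Unary.Any using (Any)
open import Data.List.Relation.Unary.All using (All)
open import Data.Product using (Σ; _×_)
open import Relation.Nullary using (¬_)
open import Relation.Binary.PropositionalEquality using (_≡_)

-- Variables are Fin n.  A literal is a variable with a polarity
-- (pos = true : positive literal v, pos = false : negative literal ¬v).
record Lit (n : ℕ) : Set where
  constructor lit
  field
    var : Fin n
    pos : Bool
open Lit public

Clause : ℕ → Set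
Clause n = List (Lit n)

CNF : ℕ → Set
CNF n = List (Clause n)

Assignment : ℕ → Set
Assignment n = Fin n → Bool

PartialAssignment : ℕ → Set
PartialAssignment n = Fin n → Maybe Bool

SatLit : ∀ {n} → Assignment n → Lit n → Set
SatLit a l = a (var l) ≡ pos l

SatC : ∀ {n} → Assignment n → Clause n → Set
SatC a C = Any (SatLit a) C

FalsC : ∀ {n} → Assignment n → Clause n → Set
FalsC a C = ¬ SatC a C

SatF : ∀ {n} → Assignment n → CNF n → Set
SatF a H = All (SatC a) H

ClauseOver : ∀ {n} → Subset n → Clause n → Set
ClauseOver V C = All (λ l → var l ∈ V) C

FormulaOver : ∀ {n} → Subset n → CNF n → Set
FormulaOver V H = All (ClauseOver V) H

Vars : ∀ {n} → PartialAssignment n → Subset n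
Vars q = tabulate (λ v → is-just (q v))

ZClause : ∀ {n} → Subset n → Clause n → Set
ZClause Z C = Any (λ l → var l ∈ Z) C

FalsifiedAreZ : ∀ {n} → CNF n → Subset n → Assignment n → Set
FalsifiedAreZ H Z p = ∀ C → C ∈ₗ H → FalsC p C → ZClause Z C

Boundary : ∀ {n} → CNF n → Subset n → Assignment n → Set
Boundary H Z p =
  ¬ SatF p H × FalsifiedAreZ H Z p × (∀ Z₁ → Z₁ ⊂ Z → ¬ FalsifiedAreZ H Z₁ p)

ImpliedByZClauses : ∀ {n} → CNF n → Subset n → Clause n → Set
ImpliedByZClauses H Z C =
  ∀ (a : Assignment n) → (∀ D → D ∈ₗ H → ZClause Z D → SatC a D) → SatC a C
  where n = _

-- p is a Z-removable boundary point of H, where VH is the variable set of H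
-- (clauses C considered are clauses over the variables of H).
Removable : ∀ {n} → CNF n → Subset n → Subset n → Assignment n → Set
Removable {n} H VH Z p =
  Σ (Subset n) (λ Z₁ → Z₁ ⊆ Z × Boundary H Z₁ p)
  × Σ (Clause n) (λ C → ClauseOver VH C × ¬ ZClause Z C × FalsC p C
                         × ImpliedByZClauses H Z C)

boolEq : Bool → Bool → Bool
boolEq true  b = b
boolEq false b = not b

litSatByQ : ∀ {n} → PartialAssignment n → Lit n → Bool
litSatByQ q l with q (var l)
... | just b  = boolEq b (pos l)
... | nothing = false

restrict : ∀ {n} → CNF n → PartialAssignment n → CNF n
restrict F q =
  map (filterᵇ (λ l → not (is-just (q (var l)))))
      (filterᵇ (λ C → not (any (litSatByQ q) C)) F)

Dis : ∀ {n} → CNF n → Subset n → CNF n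
Dis H X' = filterᵇ (λ C → not (any (λ l → lookup X' (var l)) C)) H

-- W redundant in H modulo local irredundancy, where H ∈ {F_q, Dis(F_q,X')},
-- the quantified set of H is X ─ Vars q and its variable set (X ─ Vars q) ∪ Y.
RedundantMLI : ∀ {n} → CNF n → Subset n → Subset n → PartialAssignment n
             → CNF n → Subset n → Set
RedundantMLI {n} F X Y q H W =
  ∀ (p : Assignment n) →
    Σ (Subset n) (λ W₁ → W₁ ⊆ W × Boundary H W₁ p) →
    Removable H ((X ─ Vars q) ∪ Y) (X ─ Vars q) p →
    Σ (Assignment n) (λ a → (∀ v → v ∈ Y → a v ≡ p v) × SatF a F)

module Submission where

-- Write Z = X ─ Vars q for the quantified variables of H = F_q and
-- D = Dis(H, X′).  Let p be a W-boundary point of H with W ⊆ X′ ∪ X″ that is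
-- Z-removable in H; we must extend p|Y to a model of F.  All objects are
-- finite, so we may decide whether such an extension exists and assume not.
--
-- The central step (extend-through-Dis) uses only the redundancy of X′: if
-- some point a agrees with p on Y and satisfies the Z-clauses of D, then
-- splicing a (on Z) into p (off Z) gives a point satisfying D.  Either it
-- satisfies H, and extending it by q gives a model of F, or it falsifies only
-- X′-clauses of H, hence is a boundary point below X′ that inherits the
-- removal clause of p, and redundancy of X′ applies.
--
-- Consequently, when p|Y has no extension, p falsifies D (only at
-- X″-clauses, so it is a boundary point below X″) and the clause blocking
-- p|Y is implied by the Z-clauses of D; redundancy of X″ in D then gives the
-- extension after all.

open import Defs
open import Data.Nat using (ℕ; suc; _<_)
open import Data.Nat.Properties using (<-≤-trans; ≤-pred; n<1+n)
open import Data.Fin using (Fin)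
import Data.Fin.Properties as Fin
open import Data.Fin.Subset
  using (Subset; _⊆_; _∩_; _∪_; _─_; Empty; _∈_; _∉_; _⊂_; _-_; ∣_∣; ⁅_⁆)
open import Data.Fin.Subset.Properties
  using (_∈?_; anySubset?; x∈p⇒∣p-x∣<∣p∣; p─q⊆p; x∈p∧x≢y⇒x∈p-y;
         x∈p∧x∉q⇒x∈p─q; x∈p∪q⁻; x∈p∪q⁺; x∈p∩q⁺)
open import Data.Bool using (Bool; true; false; not; T; T?; if_then_else_)
open import Data.Bool.Properties using (_≟_; T-≡; not-¬; ¬-not)
open import Data.Bool.ListAction using (any)
open import Data.Maybe using (just; nothing; is-just; fromMaybe)
open import Data.Vec using (lookup; tabulate)
open import Data.Vec.Properties using ([]=⇒lookup; lookup⇒[]=; lookup∘tabulate)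
open import Data.List using (map; filterᵇ; allFin)
import Data.List.Relation.Unary.Any as Any
import Data.List.Relation.Unary.All as All
open import Data.List.Relation.Unary.All.Properties using (map⁺; filter⁺; all-filter)
open import Data.List.Relation.Unary.Any.Properties using (any⁺; any⁻)
open import Data.List.Membership.Propositional using (find; lose)
  renaming (_∈_ to _∈ₗ_)
open import Data.List.Membership.Propositional.Properties
  using (∈-map⁺; ∈-map⁻; ∈-filter⁺; ∈-filter⁻; ∈-allFin)
open import Data.Product using (Σ; _×_; _,_)
open import Data.Sum using (inj₁; inj₂)
open import Data.Empty using (⊥-elim)
open import Function using (_∘_; id; Equivalence)
open import Relation.Nullary using (¬_; Dec; yes; no)
open import Relation.Nullary.Decidable using (_×-dec_; _→-dec_; ¬?; map′)
open import Relation.Binary.PropositionalEquality using (_≡_; refl; sym; trans; subst)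

open Equivalence using (to; from)

T-not⇒¬T : ∀ {b} → T (not b) → ¬ T b
T-not⇒¬T {false} _ ()

¬T⇒T-not : ∀ {b} → ¬ T b → T (not b)
¬T⇒T-not {false} _ = _
¬T⇒T-not {true} ¬t = ¬t _

∈⇒T-lookup : ∀ {n} {v : Fin n} {W : Subset n} → v ∈ W → T (lookup W v)
∈⇒T-lookup v∈W = T-≡ .from ([]=⇒lookup v∈W)

T-lookup⇒∈ : ∀ {n} {v : Fin n} {W : Subset n} → T (lookup W v) → v ∈ W
T-lookup⇒∈ {v = v} {W} t = lookup⇒[]= v W (T-≡ .to t)

⊆-─ : ∀ {n} {A B C : Subset n} → A ⊆ B → Empty (C ∩ A) → A ⊆ B ─ C
⊆-─ A⊆B C∩A=∅ {v} v∈A = x∈p∧x∉q⇒x∈p─q (A⊆B v∈A) (λ v∈C → C∩A=∅ (v , x∈p∩q⁺ (v∈C , v∈A)))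

∈Vars⁺ : ∀ {n} (q : PartialAssignment n) {v} → T (is-just (q v)) → v ∈ Vars q
∈Vars⁺ q {v} t = T-lookup⇒∈ (subst T (sym (lookup∘tabulate (λ w → is-just (q w)) v)) t)

∈Vars⁻ : ∀ {n} (q : PartialAssignment n) {v} → v ∈ Vars q → T (is-just (q v))
∈Vars⁻ q {v} v∈q = subst T (lookup∘tabulate (λ w → is-just (q w)) v) (∈⇒T-lookup v∈q)

satC? : ∀ {n} (a : Assignment n) (C : Clause n) → Dec (SatC a C)
satC? a = Any.any? (λ l → a (var l) ≟ pos l)

satF? : ∀ {n} (a : Assignment n) (H : CNF n) → Dec (SatF a H)
satF? a = All.all? (satC? a)

zClause? : ∀ {n} (Z : Subset n) (C : Clause n) → Dec (ZClause Z C)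
zClause? Z = Any.any? (λ l → var l ∈? Z)

falsifiedAreZ? : ∀ {n} (H : CNF n) (Z : Subset n) (p : Assignment n) →
                 Dec (FalsifiedAreZ H Z p)
falsifiedAreZ? H Z p =
  map′ (λ all C C∈H → All.lookup all C∈H) (λ f → All.tabulate (λ {C} → f C))
       (All.all? (λ C → ¬? (satC? p C) →-dec zClause? Z C) H)

satC-agree : ∀ {n} {a b : Assignment n} (C : Clause n) →
             (∀ {l} → l ∈ₗ C → a (var l) ≡ b (var l)) → SatC a C → SatC b C
satC-agree C a≡b a⊨C with find a⊨C
... | l , l∈C , a⊨l = lose l∈C (trans (sym (a≡b l∈C)) a⊨l)

-- Every set with an upward-closed decidable property P contains a ⊂-minimal
-- set with P: remove elements one by one while P persists.
module MinimalSubset {n} (P : Subset n → Set) (P? : ∀ W → Dec (P W))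
                     (P-mono : ∀ {W W′} → W ⊆ W′ → P W → P W′) where

  Minimal : Subset n → Set
  Minimal W = P W × (∀ W₀ → W₀ ⊂ W → ¬ P W₀)

  minimal-below : ∀ k W → ∣ W ∣ < k → P W →
                  Σ (Subset n) λ W₀ → W₀ ⊆ W × Minimal W₀
  minimal-below (suc k) W ∣W∣<k PW
    with Fin.any? (λ v → (v ∈? W) ×-dec P? (W - v))
  ... | yes (v , v∈W , PW-v)
    with minimal-below k (W - v) (<-≤-trans (x∈p⇒∣p-x∣<∣p∣ v∈W) (≤-pred ∣W∣<k)) PW-v
  ... | W₀ , W₀⊆W-v , min = W₀ , (λ x∈W₀ → p─q⊆p W ⁅ v ⁆ (W₀⊆W-v x∈W₀)) , min
  minimal-below (suc k) W ∣W∣<k PW | no nothing-removable =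
    W , id , PW , λ W₀ (W₀⊆W , v , v∈W , v∉W₀) PW₀ →
      nothing-removable (v , v∈W , P-mono (W₀⊆W-v W₀⊆W v∉W₀) PW₀)
    where
    W₀⊆W-v : ∀ {W₀ v} → W₀ ⊆ W → v ∉ W₀ → W₀ ⊆ W - v
    W₀⊆W-v W₀⊆W v∉W₀ x∈W₀ =
      x∈p∧x≢y⇒x∈p-y (W₀⊆W x∈W₀) (λ x≡v → v∉W₀ (subst (_∈ _) x≡v x∈W₀))

  minimal : ∀ W → P W → Σ (Subset n) λ W₀ → W₀ ⊆ W × Minimal W₀
  minimal W = minimal-below (suc ∣ W ∣) W (n<1+n _)

falsifiedAreZ-mono : ∀ {n} {H : CNF n} {p : Assignment n} {Z Z′ : Subset n} →
                     Z ⊆ Z′ → FalsifiedAreZ H Z p → FalsifiedAreZ H Z′ p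
falsifiedAreZ-mono Z⊆Z′ f C C∈H p⊭C = Any.map Z⊆Z′ (f C C∈H p⊭C)

boundary-below : ∀ {n} (H : CNF n) (p : Assignment n) (W : Subset n) →
                 ¬ SatF p H → FalsifiedAreZ H W p →
                 Σ (Subset n) λ W₀ → W₀ ⊆ W × Boundary H W₀ p
boundary-below H p W p⊭H f
  with MinimalSubset.minimal (λ Z → FalsifiedAreZ H Z p) (λ Z → falsifiedAreZ? H Z p)
                             falsifiedAreZ-mono W f
... | W₀ , W₀⊆W , min = W₀ , W₀⊆W , p⊭H , min

NonZSatisfied : ∀ {n} → CNF n → Subset n → Assignment n → Set
NonZSatisfied H Z p = ∀ C → C ∈ₗ H → ¬ ZClause Z C → SatC p C

falsifiedAreZ⇒nonZSatisfied : ∀ {n} {H : CNF n} {Z : Subset n} {p : Assignment n} →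
                              FalsifiedAreZ H Z p → NonZSatisfied H Z p
falsifiedAreZ⇒nonZSatisfied {p = p} f C C∈H ¬Z with satC? p C
... | yes p⊨C = p⊨C
... | no p⊭C = ⊥-elim (¬Z (f C C∈H p⊭C))

RemovalClause : ∀ {n} → CNF n → Subset n → Subset n → Assignment n → Set
RemovalClause {n} H V Z p =
  Σ (Clause n) λ C → ClauseOver V C × ¬ ZClause Z C × FalsC p C × ImpliedByZClauses H Z C

AgreeOn : ∀ {n} → Subset n → Assignment n → Assignment n → Set
AgreeOn Y a b = ∀ v → v ∈ Y → a v ≡ b v

-- A removal clause over Z ∪ Y only mentions Y, so it serves every point that
-- agrees with the original one on Y.
removalClause-transfer : ∀ {n} {H : CNF n} {Z Y : Subset n} {a b : Assignment n} →
                         AgreeOn Y b a → RemovalClause H (Z ∪ Y) Z a →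
                         RemovalClause H (Z ∪ Y) Z b
removalClause-transfer {Z = Z} {Y} {a} {b} b≡a (C , C-over , ¬Z , a⊭C , implied) =
  C , C-over , ¬Z , (λ b⊨C → a⊭C (satC-agree C b≡a-on-C b⊨C)) , implied
  where
  b≡a-on-C : ∀ {l} → l ∈ₗ C → b (var l) ≡ a (var l)
  b≡a-on-C l∈C with x∈p∪q⁻ Z Y (All.lookup C-over l∈C)
  ... | inj₁ v∈Z = ⊥-elim (¬Z (lose l∈C v∈Z))
  ... | inj₂ v∈Y = b≡a _ v∈Y

Extendable : ∀ {n} → CNF n → Subset n → Assignment n → Set
Extendable {n} F Y p = Σ (Assignment n) λ a → AgreeOn Y a p × SatF a F

-- Existence of a point with a decidable, extensional property is decidable:
-- points are enumerated as subsets.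
assignment? : ∀ {n} (P : Assignment n → Set) →
              (∀ {a b} → (∀ v → a v ≡ b v) → P a → P b) →
              (∀ a → Dec (P a)) → Dec (Σ (Assignment n) P)
assignment? P P-resp P? =
  map′ (λ (s , Ps) → lookup s , Ps)
       (λ (a , Pa) → tabulate a , P-resp (λ v → sym (lookup∘tabulate a v)) Pa)
       (anySubset? (P? ∘ lookup))

extendable? : ∀ {n} (F : CNF n) (Y : Subset n) (p : Assignment n) →
              Dec (Extendable F Y p)
extendable? F Y p = assignment? _ respects (λ a → agree? a ×-dec satF? a F)
  where
  agree? : ∀ a → Dec (AgreeOn Y a p)
  agree? a = Fin.all? (λ v → (v ∈? Y) →-dec (a v ≟ p v))
  respects : ∀ {a b} → (∀ v → a v ≡ b v) →
             AgreeOn Y a p × SatF a F → AgreeOn Y b p × SatF b F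
  respects a≗b (a≡p , a⊨F) =
    (λ v v∈Y → trans (sym (a≗b v)) (a≡p v v∈Y)) ,
    All.map (λ {C} → satC-agree C (λ {l} _ → a≗b (var l))) a⊨F

override : ∀ {n} → PartialAssignment n → Assignment n → Assignment n
override q a v = fromMaybe (a v) (q v)

override-free : ∀ {n} (q : PartialAssignment n) (a : Assignment n) {v} →
                v ∉ Vars q → override q a v ≡ a v
override-free q a {v} v∉q with q v in qv
... | nothing = refl
... | just _ = ⊥-elim (v∉q (∈Vars⁺ q (subst (T ∘ is-just) (sym qv) _)))

litSatByQ-sound : ∀ {n} (q : PartialAssignment n) (a : Assignment n) (l : Lit n) →
                  T (litSatByQ q l) → override q a (var l) ≡ pos l
litSatByQ-sound q a (lit v b) t with q v
... | just true = sym (T-≡ .to t)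
... | just false = sym (¬-not (λ b≡false → subst (T ∘ not) b≡false t))
... | nothing = ⊥-elim t

unassigned : ∀ {n} → PartialAssignment n → Lit n → Bool
unassigned q l = not (is-just (q (var l)))

restrict-keeps : ∀ {n} {F : CNF n} (q : PartialAssignment n) {C : Clause n} →
                 C ∈ₗ F → ¬ T (any (litSatByQ q) C) →
                 filterᵇ (unassigned q) C ∈ₗ restrict F q
restrict-keeps q C∈F q⊭C =
  ∈-map⁺ (filterᵇ (unassigned q)) (∈-filter⁺ (T? ∘ _) C∈F (¬T⇒T-not q⊭C))

restrict-over : ∀ {n} {X Y : Subset n} (F : CNF n) (q : PartialAssignment n) →
                FormulaOver (X ∪ Y) F → FormulaOver ((X ─ Vars q) ∪ Y) (restrict F q)
restrict-over {X = X} {Y} F q F-over = map⁺ (All.map clause-over (filter⁺ (T? ∘ _) F-over))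
  where
  literal-over : ∀ {l} → var l ∈ X ∪ Y × T (unassigned q l) → var l ∈ (X ─ Vars q) ∪ Y
  literal-over (v∈X∪Y , free) with x∈p∪q⁻ X Y v∈X∪Y
  ... | inj₁ v∈X = x∈p∪q⁺ (inj₁ (x∈p∧x∉q⇒x∈p─q v∈X (T-not⇒¬T free ∘ ∈Vars⁻ q)))
  ... | inj₂ v∈Y = x∈p∪q⁺ (inj₂ v∈Y)
  clause-over : ∀ {C} → ClauseOver (X ∪ Y) C → ClauseOver ((X ─ Vars q) ∪ Y) (filterᵇ (unassigned q) C)
  clause-over {C} C-over =
    All.zipWith (λ {l} → literal-over {l})
      (filter⁺ (T? ∘ unassigned q) C-over , all-filter (T? ∘ unassigned q) C)

restrict-lift : ∀ {n} (F : CNF n) (q : PartialAssignment n) (a : Assignment n) →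
                SatF a (restrict F q) → SatF (override q a) F
restrict-lift F q a a⊨Fq = All.tabulate clause-sat
  where
  clause-sat : ∀ {C} → C ∈ₗ F → SatC (override q a) C
  clause-sat {C} C∈F with T? (any (litSatByQ q) C)
  ... | yes q⊨C = Any.map (λ {l} → litSatByQ-sound q a l) (any⁻ (litSatByQ q) C q⊨C)
  ... | no q⊭C with find (All.lookup a⊨Fq (restrict-keeps q C∈F q⊭C))
  ... | l , l∈C′ , a⊨l with ∈-filter⁻ (T? ∘ unassigned q) {xs = C} l∈C′
  ... | l∈C , free = lose l∈C (trans (override-free q a (T-not⇒¬T free ∘ ∈Vars⁻ q)) a⊨l)

zClause⇒any : ∀ {n} {W : Subset n} (C : Clause n) →
              ZClause W C → T (any (λ l → lookup W (var l)) C)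
zClause⇒any {W = W} C z = any⁺ (λ l → lookup W (var l)) (Any.map ∈⇒T-lookup z)

dis-member⁻ : ∀ {n} {H : CNF n} {W : Subset n} {C : Clause n} →
              C ∈ₗ Dis H W → C ∈ₗ H × ¬ ZClause W C
dis-member⁻ {W = W} {C = C} C∈D with ∈-filter⁻ (T? ∘ _) C∈D
... | C∈H , kept = C∈H , T-not⇒¬T kept ∘ zClause⇒any {W = W} C

dis-member⁺ : ∀ {n} {H : CNF n} {W : Subset n} {C : Clause n} →
              C ∈ₗ H → ¬ ZClause W C → C ∈ₗ Dis H W
dis-member⁺ {W = W} {C} C∈H ¬W =
  ∈-filter⁺ (T? ∘ _) C∈H
    (¬T⇒T-not (λ t → ¬W (Any.map T-lookup⇒∈ (any⁻ (λ l → lookup W (var l)) C t))))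

dis-sat⇒falsifiedAreZ : ∀ {n} (H : CNF n) (W : Subset n) (a : Assignment n) →
                        SatF a (Dis H W) → FalsifiedAreZ H W a
dis-sat⇒falsifiedAreZ H W a a⊨D C C∈H a⊭C with zClause? W C
... | yes z = z
... | no ¬W = ⊥-elim (a⊭C (All.lookup a⊨D (dis-member⁺ C∈H ¬W)))

dis-falsifiedAreZ : ∀ {n} {H : CNF n} (W W′ : Subset n) {p : Assignment n} →
                    FalsifiedAreZ H (W ∪ W′) p → FalsifiedAreZ (Dis H W) W′ p
dis-falsifiedAreZ W W′ f C C∈D p⊭C with dis-member⁻ C∈D
... | C∈H , ¬W with find (f C C∈H p⊭C)
... | l , l∈C , v∈W∪W′ with x∈p∪q⁻ W W′ v∈W∪W′
... | inj₁ v∈W = ⊥-elim (¬W (lose l∈C v∈W))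
... | inj₂ v∈W′ = lose l∈C v∈W′

splice : ∀ {n} → Subset n → Assignment n → Assignment n → Assignment n
splice Z a b v = if lookup Z v then a v else b v

splice-in : ∀ {n} (Z : Subset n) (a b : Assignment n) {v} → v ∈ Z → splice Z a b v ≡ a v
splice-in Z a b v∈Z rewrite []=⇒lookup v∈Z = refl

splice-out : ∀ {n} (Z : Subset n) (a b : Assignment n) {v} → v ∉ Z → splice Z a b v ≡ b v
splice-out Z a b {v} v∉Z with lookup Z v in Zv
... | true = ⊥-elim (v∉Z (lookup⇒[]= v Z Zv))
... | false = refl

blocking : ∀ {n} → Subset n → Assignment n → Clause n
blocking {n} Y p = map (λ v → lit v (not (p v))) (filterᵇ (lookup Y) (allFin n))

blocking-over : ∀ {n} (Y : Subset n) (p : Assignment n) → ClauseOver Y (blocking Y p)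
blocking-over {n} Y p = map⁺ (All.map T-lookup⇒∈ (all-filter (T? ∘ lookup Y) (allFin n)))

blocking-falsified : ∀ {n} (Y : Subset n) (p : Assignment n) → FalsC p (blocking Y p)
blocking-falsified Y p p⊨C with find p⊨C
... | l , l∈C , p⊨l with ∈-map⁻ (λ v → lit v (not (p v))) l∈C
... | v , _ , refl = not-¬ refl p⊨l

blocking-unsat⇒agree : ∀ {n} (Y : Subset n) (p a : Assignment n) →
                       ¬ SatC a (blocking Y p) → AgreeOn Y a p
blocking-unsat⇒agree {n} Y p a a⊭C v v∈Y with a v ≟ p v
... | yes a≡p = a≡p
... | no a≢p = ⊥-elim (a⊭C (lose v-literal (¬-not a≢p)))
  where
  v-literal : lit v (not (p v)) ∈ₗ blocking Y p
  v-literal = ∈-map⁺ (λ w → lit w (not (p w)))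
                (∈-filter⁺ (T? ∘ lookup Y) (∈-allFin v) (∈⇒T-lookup v∈Y))

module Composition {n : ℕ} (X Y : Subset n) (F : CNF n) (q : PartialAssignment n)
  (X′ X″ : Subset n) (X∩Y=∅ : Empty (X ∩ Y)) (F-over : FormulaOver (X ∪ Y) F)
  (q⊆X : Vars q ⊆ X) (X′⊆Z : X′ ⊆ X ─ Vars q) (X″⊆Z : X″ ⊆ X ─ Vars q)
  (X′-redundant : RedundantMLI F X Y q (restrict F q) X′)
  (X″-redundant : RedundantMLI F X Y q (Dis (restrict F q) X′) X″) where

  Z : Subset n
  Z = X ─ Vars q

  H : CNF n
  H = restrict F q

  D : CNF n
  D = Dis H X′

  Y∉Z : ∀ {v} → v ∈ Y → v ∉ Z
  Y∉Z {v} v∈Y v∈Z = X∩Y=∅ (v , x∈p∩q⁺ (p─q⊆p X (Vars q) v∈Z , v∈Y))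

  Y∉Vars : ∀ {v} → v ∈ Y → v ∉ Vars q
  Y∉Vars {v} v∈Y v∈q = X∩Y=∅ (v , x∈p∩q⁺ (q⊆X v∈q , v∈Y))

  splice-agrees : ∀ a p → AgreeOn Y (splice Z a p) p
  splice-agrees a p v v∈Y = splice-out Z a p (Y∉Z v∈Y)

  -- Splicing a (on Z) into p (off Z) satisfies D: Z-clauses of D see only
  -- Z ∪ Y, where the splice agrees with a; the other clauses hold under p.
  splice-satisfies-Dis : ∀ {p a} → NonZSatisfied H Z p → AgreeOn Y a p →
                         (∀ C → C ∈ₗ D → ZClause Z C → SatC a C) → SatF (splice Z a p) D
  splice-satisfies-Dis {p} {a} p⊨nonZ a≡p a⊨DZ = All.tabulate clause-sat
    where
    a≡splice : ∀ {C l} → C ∈ₗ H → l ∈ₗ C → a (var l) ≡ splice Z a p (var l)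
    a≡splice {C} C∈H l∈C with x∈p∪q⁻ Z Y (All.lookup (All.lookup (restrict-over F q F-over) C∈H) l∈C)
    ... | inj₁ v∈Z = sym (splice-in Z a p v∈Z)
    ... | inj₂ v∈Y = trans (a≡p _ v∈Y) (sym (splice-agrees a p _ v∈Y))
    clause-sat : ∀ {C} → C ∈ₗ D → SatC (splice Z a p) C
    clause-sat {C} C∈D with dis-member⁻ {H = H} {W = X′} C∈D | zClause? Z C
    ... | C∈H , _ | yes z = satC-agree C (a≡splice C∈H) (a⊨DZ C C∈D z)
    ... | C∈H , _ | no ¬Z =
      satC-agree C (λ l∈C → sym (splice-out Z a p (¬Z ∘ lose l∈C))) (p⊨nonZ C C∈H ¬Z)

  extend-through-Dis : ∀ p → NonZSatisfied H Z p → RemovalClause H (Z ∪ Y) Z p →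
                       ∀ a → AgreeOn Y a p → (∀ C → C ∈ₗ D → ZClause Z C → SatC a C) →
                       Extendable F Y p
  extend-through-Dis p p⊨nonZ removal a a≡p a⊨DZ with satF? (splice Z a p) H
  ... | yes s⊨H =
    override q (splice Z a p) ,
    (λ v v∈Y → trans (override-free q (splice Z a p) (Y∉Vars v∈Y)) (splice-agrees a p v v∈Y)) ,
    restrict-lift F q _ s⊨H
  ... | no s⊭H
    with boundary-below H (splice Z a p) X′ s⊭H
           (dis-sat⇒falsifiedAreZ H X′ _ (splice-satisfies-Dis p⊨nonZ a≡p a⊨DZ))
  ... | W , W⊆X′ , boundary
    with X′-redundant (splice Z a p) (W , W⊆X′ , boundary)
           ((W , X′⊆Z ∘ W⊆X′ , boundary) , removalClause-transfer (splice-agrees a p) removal)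
  ... | b , b≡s , b⊨F = b , (λ v v∈Y → trans (b≡s v v∈Y) (splice-agrees a p v v∈Y)) , b⊨F

  -- If p|Y has no extension, p falsifies D (take a = p above) ...
  Dis-falsified : ∀ p → NonZSatisfied H Z p → RemovalClause H (Z ∪ Y) Z p →
                  ¬ Extendable F Y p → ¬ SatF p D
  Dis-falsified p p⊨nonZ removal ¬ext p⊨D =
    ¬ext (extend-through-Dis p p⊨nonZ removal p (λ _ _ → refl) (λ C C∈D _ → All.lookup p⊨D C∈D))

  -- ... and the clause blocking p|Y is a removal clause of p in D: a point
  -- falsifying it agrees with p on Y, so it cannot satisfy the Z-clauses of D.
  blocking-removal : ∀ p → NonZSatisfied H Z p → RemovalClause H (Z ∪ Y) Z p →
                     ¬ Extendable F Y p → RemovalClause D (Z ∪ Y) Z p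
  blocking-removal p p⊨nonZ removal ¬ext =
    blocking Y p , All.map (x∈p∪q⁺ ∘ inj₂) (blocking-over Y p) , not-Z ,
    blocking-falsified Y p , implied
    where
    not-Z : ¬ ZClause Z (blocking Y p)
    not-Z z with find z
    ... | l , l∈C , v∈Z = Y∉Z (All.lookup (blocking-over Y p) l∈C) v∈Z
    implied : ImpliedByZClauses D Z (blocking Y p)
    implied a a⊨DZ with satC? a (blocking Y p)
    ... | yes a⊨C = a⊨C
    ... | no a⊭C = ⊥-elim (¬ext (extend-through-Dis p p⊨nonZ removal a
                                   (blocking-unsat⇒agree Y p a a⊭C) a⊨DZ))

  union-nonZSatisfied : ∀ {p} → FalsifiedAreZ H (X′ ∪ X″) p → NonZSatisfied H Z p
  union-nonZSatisfied p-falsified =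
    falsifiedAreZ⇒nonZSatisfied (falsifiedAreZ-mono X′∪X″⊆Z p-falsified)
    where
    X′∪X″⊆Z : X′ ∪ X″ ⊆ Z
    X′∪X″⊆Z v∈X′∪X″ with x∈p∪q⁻ X′ X″ v∈X′∪X″
    ... | inj₁ v∈X′ = X′⊆Z v∈X′
    ... | inj₂ v∈X″ = X″⊆Z v∈X″

  extendable : ∀ p → FalsifiedAreZ H (X′ ∪ X″) p → RemovalClause H (Z ∪ Y) Z p →
               Extendable F Y p
  extendable p p-falsified removal with extendable? F Y p
  ... | yes p-extendable = p-extendable
  ... | no ¬ext
    with boundary-below D p X″
           (Dis-falsified p (union-nonZSatisfied p-falsified) removal ¬ext)
           (dis-falsifiedAreZ X′ X″ p-falsified)
  ... | W″ , W″⊆X″ , boundary =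
    X″-redundant p (W″ , W″⊆X″ , boundary)
      ((W″ , X″⊆Z ∘ W″⊆X″ , boundary) ,
       blocking-removal p (union-nonZSatisfied p-falsified) removal ¬ext)

  redundant-union : RedundantMLI F X Y q H (X′ ∪ X″)
  redundant-union p (W , W⊆X′∪X″ , _ , W-falsified , _) (_ , removal) =
    extendable p (falsifiedAreZ-mono W⊆X′∪X″ W-falsified) removal

-- The theorem.
lemma7 : (n : ℕ) (X Y : Subset n) (F : CNF n) (q : PartialAssignment n)
    (X′ X″ : Subset n) →
    Empty (X ∩ Y) → FormulaOver (X ∪ Y) F →
    Vars q ⊆ X → X′ ⊆ X → X″ ⊆ X →
    Empty (Vars q ∩ X′) → Empty (Vars q ∩ X″) → Empty (X′ ∩ X″) →
    RedundantMLI F X Y q (restrict F q) X′ →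
    RedundantMLI F X Y q (Dis (restrict F q) X′) X″ →
    RedundantMLI F X Y q (restrict F q) (X′ ∪ X″)
lemma7 n X Y F q X′ X″ X∩Y=∅ F-over q⊆X X′⊆X X″⊆X q∩X′=∅ q∩X″=∅ _ X′-redundant X″-redundant =
  Composition.redundant-union X Y F q X′ X″ X∩Y=∅ F-over q⊆X
    (⊆-─ X′⊆X q∩X′=∅) (⊆-─ X″⊆X q∩X″=∅) X′-redundant X″-redundant
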